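{- Let $G$ be a finite directed multigraph without loops and oriented 2-cycles which is block-decomposable. Suppose $G$ contains distinct nodes $o,w,p,q,y$ such that the only edges of $G$ incident to $o$ are the single edges $w\to o$, $o\to p$, $o\to q$, $o\to y$, that $G$ contains the edges $p\to w$ and $q\to w$, and that $y$ and $w$ are not joined by an edge. Then in every block decomposition of $G$, the five edges $w\to o$, $o\to p$, $o\to q$, $p\to w$, $q\to w$ form a single diamond block (with mid-edge $w\to o$), and the edge $o\to y$ is a spike block.
   Context: Blocks are the following directed graphs; every node of a block is colored white (an "outlet") or black (a "dead end"). Spike: a single edge $u\to v$, with $u,v$ both white. Triangle: an oriented 3-cycle $u\to v\to w\to u$, with all three nodes white. Fork: a white node $c$ and two black nodes $p,q$, with either the two edges $c\to p$, $c\to q$ or the two edges $p\to c$, $q\to c$. Diamond: white nodes $u,v$ and black nodes $p,q$, with edges $u\to v$ (the mid-edge), $v\to p$, $p\to u$, $v\to q$, $q\to u$ (boundary edges). Square: a white central node $o$ and black corner nodes $a,b,c,d$, with edges $o\to a$, $a\to b$, $b\to o$, $o\to c$, $c\to b$, $c\to d$, $d\to o$, $a\to d$. A block decomposition of a directed graph $G$ is a way of obtaining $G$ from a finite disjoint union of blocks by repeatedly identifying two white nodes belonging to different blocks, each white node being identified at most once and black nodes never identified; the identified node becomes black. If two edges then join the same two nodes, they form a double edge if they have the same direction and are both removed (annihilate) if they have opposite directions. $G$ is block-decomposable if it admits a block decomposition. -}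

module Defs where

open import Data.Nat using (ℕ; zero; suc; _∸_)
open import Data.Bool using (Bool; true; false)
open import Data.Fin using (Fin; zero; suc; _≟_)
open import Data.Fin.Base using (Fin)
open import Data.List using (List; []; _∷_; length; filter; map; allFin)
open import Data.Nat.ListAction using (sum)
open import Data.Product using (Σ; ∃; _×_; _,_; proj₁; proj₂)
open import Relation.Binary.PropositionalEquality using (_≡_; _≢_; refl)
open import Relation.Nullary.Decidable using (_×-dec_)
open import Data.Empty using (⊥)

-- The five kinds of blocks (forks come in two orientations).
data BlockType : Set where
  spike triangle forkOut forkIn diamond square : BlockType

size : BlockType → ℕ
size spike    = 2
size triangle = 3
size forkOut  = 3
size forkIn   = 3
size diamond  = 4
size square   = 5

-- Node numbering conventions:
--   spike    : u=0, v=1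
--   triangle : u=0, v=1, w=2
--   fork     : c=0 (white), p=1, q=2 (black)
--   diamond  : u=0, v=1 (white), p=2, q=3 (black); mid-edge u→v
--   square   : o=0 (white), a=1, b=2, c=3, d=4 (black)
-- white t x ≡ true  iff node x of a block of type t is white (an outlet)
white : (t : BlockType) → Fin (size t) → Bool
white spike    _ = true
white triangle _ = true
white forkOut  zero = true
white forkOut  (suc _) = false
white forkIn   zero = true
white forkIn   (suc _) = false
white diamond  zero = true
white diamond  (suc zero) = true
white diamond  (suc (suc _)) = false
white square   zero = true
white square   (suc _) = false

n0 : ∀ {k} → Fin (suc k)
n0 = zero
n1 : ∀ {k} → Fin (suc (suc k))
n1 = suc zero
n2 : ∀ {k} → Fin (suc (suc (suc k)))
n2 = suc n1
n3 : ∀ {k} → Fin (suc (suc (suc (suc k))))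
n3 = suc n2
n4 : ∀ {k} → Fin (suc (suc (suc (suc (suc k)))))
n4 = suc n3

edges : (t : BlockType) → List (Fin (size t) × Fin (size t))
edges spike    = (n0 , n1) ∷ []
edges triangle = (n0 , n1) ∷ (n1 , n2) ∷ (n2 , n0) ∷ []
edges forkOut  = (n0 , n1) ∷ (n0 , n2) ∷ []
edges forkIn   = (n1 , n0) ∷ (n2 , n0) ∷ []
edges diamond  = (n0 , n1) ∷ (n1 , n2) ∷ (n2 , n0) ∷ (n1 , n3) ∷ (n3 , n0) ∷ []
edges square   = (n0 , n1) ∷ (n1 , n2) ∷ (n2 , n0) ∷ (n0 , n3) ∷ (n3 , n2) ∷ (n3 , n4) ∷ (n4 , n0) ∷ (n1 , n4) ∷ []

Multigraph : ℕ → Set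
Multigraph n = Fin n → Fin n → ℕ

NoLoops : ∀ {n} → Multigraph n → Set
NoLoops {n} E = ∀ (a : Fin n) → E a a ≡ 0

No2Cycles : ∀ {n} → Multigraph n → Set
No2Cycles {n} E = ∀ (a b : Fin n) → E a b ≡ 0 ⊎' E b a ≡ 0
  where open import Data.Sum renaming (_⊎_ to _⊎'_)

UNode : ∀ {m} → (Fin m → BlockType) → Set
UNode {m} block = Σ (Fin m) (λ i → Fin (size (block i)))

IsWhite : ∀ {m} (block : Fin m → BlockType) → UNode block → Set
IsWhite block (i , x) = white (block i) x ≡ true

edgeCount : ∀ {m n} (block : Fin m → BlockType) → (UNode block → Fin n) →
            Fin n → Fin n → ℕ
edgeCount {m} block φ a b =
  sum (map (λ i → length (filter (λ e → (φ (i , proj₁ e) ≟ a) ×-dec (φ (i , proj₂ e) ≟ b))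
                                 (edges (block i))))
           (allFin m))

-- A block decomposition of the multigraph E, including the isomorphism of
-- the glued graph with E: φ sends nodes of the disjoint union of the blocks
-- to nodes of E, and is the quotient map of the identification of nodes.
record BlockDecomposition {n : ℕ} (E : Multigraph n) : Set where
  field
    m     : ℕ
    block : Fin m → BlockType
    φ     : UNode block → Fin n
    surj  : ∀ (a : Fin n) → ∃ λ x → φ x ≡ a
    glue  : ∀ (x y : UNode block) → x ≢ y → φ x ≡ φ y →
            IsWhite block x × IsWhite block y × proj₁ x ≢ proj₁ y
    once  : ∀ (x y z : UNode block) → x ≢ y → y ≢ z → x ≢ z →
            φ x ≡ φ y → φ y ≡ φ z → ⊥
    -- after annihilating pairs of opposite edges, the multiplicities are those of E
    mult  : ∀ (a b : Fin n) → E a b ≡ edgeCount block φ a b ∸ edgeCount block φ b a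

BlockDecomposable : ∀ {n} → Multigraph n → Set
BlockDecomposable E = BlockDecomposition E

castNode : ∀ {t t' : BlockType} → t ≡ t' → Fin (size t') → Fin (size t)
castNode refl x = x

-- Every arc of the glued graph at o lifts to a block arc at a preimage of o, and an arc of the
-- disjoint union that is absent from G must be cancelled by an opposite one.  As o has three
-- distinct out-neighbours and no block node has more than two, o has exactly two preimages X, Y,
-- white and in different blocks; X is taken to receive the lift of w → o.  Cancellation forces
-- black in-neighbours of X and Y to lie over w and black out-neighbours over p, q or y; since
-- black nodes are never identified, neither X nor Y has two black in-neighbours.  Since E y w = 0,
-- an arc over y → w needs a cancelling arc over w → y, impossible once both preimages of w lead
-- only to preimages of o.  Going through the positions X can occupy, these facts exclude all but
-- the head of a diamond whose tail lies over w and whose feet lie over p and q; the arc to y then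
-- leaves Y, all of whose black out-neighbours lie over y, so Y is the tail of a spike.
module Submission where

open import Defs
open import Axiom.UniquenessOfIdentityProofs using (module Decidable⇒UIP)
open import Data.Bool using (true; false)
open import Data.Empty using (⊥; ⊥-elim)
open import Data.Fin using (Fin; zero; suc; _≟_)
open import Data.Fin.Properties using (all?)
open import Data.List using (List; _∷_; length; map; allFin)
open import Data.List.Membership.Propositional using (_∈_)
open import Data.List.Membership.Propositional.Properties using (∈-filter⁺; ∈-filter⁻; ∈-allFin)
open import Data.List.Membership.DecPropositional using () renaming (_∈?_ to ∈?[_])
open import Data.List.Relation.Unary.Any using (here; there)
open import Data.Nat using (ℕ; zero; suc; _≤_; z≤n; s≤s)
open import Data.Nat.ListAction using (sum)
open import Data.Nat.Properties using (≤-trans; m≤m+n; m≤n+m; m∸n≤m; m∸n≡0⇒m≤n)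
open import Data.Product using (Σ; ∃; ∃₂; _×_; _,_; proj₁; proj₂)
open import Data.Product.Properties using (,-injectiveʳ-UIP) renaming (≡-dec to ×-≡-dec)
open import Data.Sum using (_⊎_; inj₁; inj₂; [_,_])
open import Relation.Binary.PropositionalEquality using (_≡_; _≢_; refl; sym; trans; cong; subst)
open import Relation.Nullary using (Dec; yes; no; ¬_)
open import Relation.Nullary.Decidable using (True; toWitness; from-yes; ¬?; _→-dec_; _⊎-dec_; _×-dec_)

Edge : (t : BlockType) → Fin (size t) → Fin (size t) → Set
Edge t a b = (a , b) ∈ edges t

edge? : ∀ t a b → Dec (Edge t a b)
edge? t a b = ∈?[ ×-≡-dec _≟_ _≟_ ] (a , b) (edges t)

edge! : ∀ t a b → {True (edge? t a b)} → Edge t a b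
edge! t a b {h} = toWitness h

forEveryBlockType : {P : BlockType → Set} (P? : ∀ t → Dec (P t)) →
  {_ : True (P? spike)} {_ : True (P? triangle)} {_ : True (P? forkOut)} →
  {_ : True (P? forkIn)} {_ : True (P? diamond)} {_ : True (P? square)} →
  ∀ t → P t
forEveryBlockType P? {h} spike = toWitness h
forEveryBlockType P? {_} {h} triangle = toWitness h
forEveryBlockType P? {_} {_} {h} forkOut = toWitness h
forEveryBlockType P? {_} {_} {_} {h} forkIn = toWitness h
forEveryBlockType P? {_} {_} {_} {_} {h} diamond = toWitness h
forEveryBlockType P? {_} {_} {_} {_} {_} {h} square = toWitness h

edge-asym : ∀ t {a b} → Edge t a b → ¬ Edge t b a
edge-asym t {a} {b} = forEveryBlockType
  (λ t → all? λ a → all? λ b → edge? t a b →-dec ¬? (edge? t b a)) t a b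

out-degree≤2 : ∀ t {v a b c} → Edge t v a → Edge t v b → Edge t v c → a ≡ b ⊎ a ≡ c ⊎ b ≡ c
out-degree≤2 t {v} {a} {b} {c} = forEveryBlockType
  (λ t → all? λ v → all? λ a → all? λ b → all? λ c →
     edge? t v a →-dec edge? t v b →-dec edge? t v c →-dec
     (a ≟ b ⊎-dec a ≟ c ⊎-dec b ≟ c)) t v a b c

spike-edge : ∀ {a b} → Edge spike a b → a ≡ n0 × b ≡ n1
spike-edge (here refl) = refl , refl

spike-out-unique : ∀ {a b b′} → Edge spike a b → Edge spike a b′ → b ≡ b′
spike-out-unique (here refl) (here refl) = refl

next : Fin 3 → Fin 3
next zero = n1
next (suc zero) = n2
next (suc (suc zero)) = n0

prev : Fin 3 → Fin 3
prev a = next (next a)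

triangle-edge : ∀ a → Edge triangle a (next a)
triangle-edge zero = here refl
triangle-edge (suc zero) = there (here refl)
triangle-edge (suc (suc zero)) = there (there (here refl))

triangle-edge-into : ∀ a → Edge triangle (prev a) a
triangle-edge-into zero = triangle-edge n2
triangle-edge-into (suc zero) = triangle-edge n0
triangle-edge-into (suc (suc zero)) = triangle-edge n1

next-prev : ∀ a → next (prev a) ≡ a
next-prev zero = refl
next-prev (suc zero) = refl
next-prev (suc (suc zero)) = refl

triangle-out : ∀ {a b} → Edge triangle a b → b ≡ next a
triangle-out (here refl) = refl
triangle-out (there (here refl)) = refl
triangle-out (there (there (here refl))) = refl

triangle-out-unique : ∀ {a b b′} → Edge triangle a b → Edge triangle a b′ → b ≡ b′
triangle-out-unique e e′ = trans (triangle-out e) (sym (triangle-out e′))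

triangle-in : ∀ {a b} → Edge triangle a b → a ≡ prev b
triangle-in (here refl) = refl
triangle-in (there (here refl)) = refl
triangle-in (there (there (here refl))) = refl

forkOut-edge : ∀ {a b} → Edge forkOut a b → a ≡ n0 × (b ≡ n1 ⊎ b ≡ n2)
forkOut-edge (here refl) = refl , inj₁ refl
forkOut-edge (there (here refl)) = refl , inj₂ refl

forkOut-leaf-black : ∀ {a b} → Edge forkOut a b → white forkOut b ≡ false
forkOut-leaf-black (here refl) = refl
forkOut-leaf-black (there (here refl)) = refl

forkOut-no-path : ∀ {a b c} → Edge forkOut a b → ¬ Edge forkOut b c
forkOut-no-path {a} {b} {c} = from-yes (all? λ a → all? λ b → all? λ c →
  edge? forkOut a b →-dec ¬? (edge? forkOut b c)) a b c

diamond-in-of-head : ∀ {a} → Edge diamond a n1 → a ≡ n0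
diamond-in-of-head {a} = from-yes (all? λ a → edge? diamond a n1 →-dec a ≟ n0) a

diamond-out-of-head : ∀ {b} → Edge diamond n1 b → b ≡ n2 ⊎ b ≡ n3
diamond-out-of-head {b} = from-yes (all? λ b → edge? diamond n1 b →-dec (b ≟ n2 ⊎-dec b ≟ n3)) b

diamond-out-of-tail : ∀ {b} → Edge diamond n0 b → b ≡ n1
diamond-out-of-tail {b} = from-yes (all? λ b → edge? diamond n0 b →-dec b ≟ n1) b

diamond-foot-black : ∀ {f} → Edge diamond n1 f → white diamond f ≡ false
diamond-foot-black e with diamond-out-of-head e
... | inj₁ refl = refl
... | inj₂ refl = refl

diamond-foot-to-tail : ∀ {f} → Edge diamond n1 f → Edge diamond f n0
diamond-foot-to-tail {f} = from-yes (all? λ f → edge? diamond n1 f →-dec edge? diamond f n0) f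

diamond-in-of-foot : ∀ {f a} → Edge diamond n1 f → Edge diamond a f → a ≡ n1
diamond-in-of-foot {f} {a} = from-yes (all? λ f → all? λ a →
  edge? diamond n1 f →-dec edge? diamond a f →-dec a ≟ n1) f a

diamond-out-of-foot : ∀ {f b} → Edge diamond n1 f → Edge diamond f b → b ≡ n0
diamond-out-of-foot {f} {b} = from-yes (all? λ f → all? λ b →
  edge? diamond n1 f →-dec edge? diamond f b →-dec b ≟ n0) f b

nonempty-member : ∀ {A : Set} {xs : List A} → 1 ≤ length xs → ∃ (_∈ xs)
nonempty-member {xs = x ∷ _} _ = x , here refl

member-nonempty : ∀ {A : Set} {x : A} {xs : List A} → x ∈ xs → 1 ≤ length xs
member-nonempty (here _) = s≤s z≤n
member-nonempty (there _) = s≤s z≤n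

sum-map-positive : ∀ {A : Set} (f : A → ℕ) (xs : List A) → 1 ≤ sum (map f xs) → ∃ λ x → 1 ≤ f x
sum-map-positive f (x ∷ xs) h with f x in fx
... | zero = sum-map-positive f xs h
... | suc _ = x , subst (1 ≤_) (sym fx) (s≤s z≤n)

f≤sum-map : ∀ {A : Set} (f : A → ℕ) {x : A} {xs : List A} → x ∈ xs → f x ≤ sum (map f xs)
f≤sum-map f {xs = x ∷ xs} (here refl) = m≤m+n (f x) _
f≤sum-map f {xs = x ∷ xs} (there x∈) = ≤-trans (f≤sum-map f x∈) (m≤n+m _ (f x))

module Glued {n : ℕ} {E : Multigraph n} (D : BlockDecomposition E) where
  open BlockDecomposition D

  Node : Set
  Node = UNode block

  White : Node → Set
  White = IsWhite block

  SameBlock : Node → Node → Set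
  SameBlock x z = proj₁ x ≡ proj₁ z

  data Arc : Node → Node → Set where
    arc : ∀ {i a b} → Edge (block i) a b → Arc (i , a) (i , b)

  arc-sameBlock : ∀ {x z} → Arc x z → SameBlock x z
  arc-sameBlock (arc _) = refl

  arc-asym : ∀ {x z} → Arc x z → ¬ Arc z x
  arc-asym (arc e) (arc e′) = edge-asym _ e e′

  record ArcOver (a b : Fin n) : Set where
    constructor over
    field
      {src tgt} : Node
      isArc : Arc src tgt
      src↦ : φ src ≡ a
      tgt↦ : φ tgt ≡ b

  OutTo : Node → Fin n → Set
  OutTo x c = ∃ λ z → Arc x z × φ z ≡ c

  LeadsTo : Node → Fin n → Set
  LeadsTo x c = ∀ {z} → Arc x z → φ z ≡ c

  private
    hits : (a b : Fin n) (i : Fin m) (e : Fin (size (block i)) × Fin (size (block i))) →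
           Dec (φ (i , proj₁ e) ≡ a × φ (i , proj₂ e) ≡ b)
    hits a b i e = (φ (i , proj₁ e) ≟ a) ×-dec (φ (i , proj₂ e) ≟ b)

  arcOver-of-count : ∀ {a b} → 1 ≤ edgeCount block φ a b → ArcOver a b
  arcOver-of-count {a} {b} h with sum-map-positive _ (allFin m) h
  ... | i , h′ with nonempty-member h′
  ... | _ , e∈ with ∈-filter⁻ (hits a b i) {xs = edges (block i)} e∈
  ... | e , s↦ , t↦ = over (arc e) s↦ t↦

  count-of-arcOver : ∀ {a b} → ArcOver a b → 1 ≤ edgeCount block φ a b
  count-of-arcOver {a} {b} (over (arc {i} e) s↦ t↦) =
    ≤-trans (member-nonempty (∈-filter⁺ (hits a b i) e (s↦ , t↦))) (f≤sum-map _ (∈-allFin i))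

  arcOver-of-edge : ∀ {a b} → 1 ≤ E a b → ArcOver a b
  arcOver-of-edge {a} {b} h =
    arcOver-of-count (≤-trans (subst (1 ≤_) (mult a b) h) (m∸n≤m _ (edgeCount block φ b a)))

  reverse-arcOver : ∀ {a b} → E a b ≡ 0 → ArcOver a b → ArcOver b a
  reverse-arcOver {a} {b} h α =
    arcOver-of-count (≤-trans (count-of-arcOver α) (m∸n≡0⇒m≤n (trans (sym (mult a b)) h)))

  _≟ᴺ_ : (x z : Node) → Dec (x ≡ z)
  _≟ᴺ_ = ×-≡-dec _≟_ _≟_

  identified : ∀ {x z} → φ x ≡ φ z → x ≡ z ⊎ (White x × White z × ¬ SameBlock x z)
  identified {x} {z} x↦z with x ≟ᴺ z
  ... | yes x≡z = inj₁ x≡z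
  ... | no x≢z = inj₂ (glue x z x≢z x↦z)

  black-unique : ∀ {x z} → ¬ White z → φ x ≡ φ z → x ≡ z
  black-unique z-black x↦z with identified x↦z
  ... | inj₁ x≡z = x≡z
  ... | inj₂ (_ , z-white , _) = ⊥-elim (z-black z-white)

  sameBlock-unique : ∀ {x z} → SameBlock x z → φ x ≡ φ z → x ≡ z
  sameBlock-unique same x↦z with identified x↦z
  ... | inj₁ x≡z = x≡z
  ... | inj₂ (_ , _ , ¬same) = ⊥-elim (¬same same)

  fibre≤2 : ∀ {x z s} → x ≢ z → φ x ≡ φ z → φ s ≡ φ x → s ≡ x ⊎ s ≡ z
  fibre≤2 {x} {z} {s} x≢z x↦z s↦x with s ≟ᴺ x | s ≟ᴺ z
  ... | yes s≡x | _ = inj₁ s≡x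
  ... | no _ | yes s≡z = inj₂ s≡z
  ... | no s≢x | no s≢z = ⊥-elim (once s x z s≢x x≢z s≢z s↦x x↦z)

  ¬sameBlock⇒≢ : ∀ {x z} → ¬ SameBlock x z → x ≢ z
  ¬sameBlock⇒≢ ¬same x≡z = ¬same (cong proj₁ x≡z)

  reverse-arc-other-block : ∀ {x z x′ z′} → Arc x z → Arc z′ x′ → φ z′ ≡ φ z → φ x′ ≡ φ x →
    ¬ SameBlock z′ z
  reverse-arc-other-block α β z′↦z x′↦x same
    with sameBlock-unique same z′↦z
       | sameBlock-unique (trans (sym (arc-sameBlock β)) (trans same (sym (arc-sameBlock α)))) x′↦x
  ... | refl | refl = arc-asym α β

  split-arcOver : ∀ {x z a c} → x ≢ z → φ x ≡ a → φ z ≡ a → ArcOver a c → OutTo x c ⊎ OutTo z c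
  split-arcOver x≢z x↦a z↦a (over {s} {t} α s↦a t↦c)
    with fibre≤2 x≢z (trans x↦a (sym z↦a)) (trans s↦a (sym x↦a))
  ... | inj₁ refl = inj₁ (t , α , t↦c)
  ... | inj₂ refl = inj₂ (t , α , t↦c)

  out-images≤2 : ∀ {x a b c} → OutTo x a → OutTo x b → OutTo x c → a ≡ b ⊎ a ≡ c ⊎ b ≡ c
  out-images≤2 (_ , arc e₁ , refl) (_ , arc e₂ , refl) (_ , arc e₃ , refl)
    with out-degree≤2 _ e₁ e₂ e₃
  ... | inj₁ refl = inj₁ refl
  ... | inj₂ (inj₁ refl) = inj₂ (inj₁ refl)
  ... | inj₂ (inj₂ refl) = inj₂ (inj₂ refl)

  -- A block of type t inside the decomposition, nodes indexed by g; unlike the type 'block i',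
  -- the index t can be case-split on.
  record Embedding (t : BlockType) (g : Fin (size t) → Node) : Set where
    field
      arc⁺ : ∀ {a b} → Edge t a b → Arc (g a) (g b)
      out⁻ : ∀ {a z} → Arc (g a) z → ∃ λ b → z ≡ g b × Edge t a b
      in⁻ : ∀ {a z} → Arc z (g a) → ∃ λ b → z ≡ g b × Edge t b a
      white⁻ : ∀ {a} → White (g a) → white t a ≡ true
      sameBlock : ∀ a b → SameBlock (g a) (g b)
      φ-injective : ∀ {a b} → φ (g a) ≡ φ (g b) → a ≡ b

    black : ∀ {a} → white t a ≡ false → ¬ White (g a)
    black {a} a-black a-white with trans (sym a-black) (white⁻ a-white)
    ... | ()

    outTo⁻ : ∀ {a c} → OutTo (g a) c → ∃ λ b → Edge t a b × φ (g b) ≡ c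
    outTo⁻ (_ , α , z↦c) with out⁻ α
    ... | b , refl , e = b , e , z↦c

    same-out-image : ∀ {a c c′} → (∀ {b b′} → Edge t a b → Edge t a b′ → b ≡ b′) →
      OutTo (g a) c → OutTo (g a) c′ → c ≡ c′
    same-out-image one-out z z′ with outTo⁻ z | outTo⁻ z′
    ... | b , e , b↦c | b′ , e′ , b′↦c′ = trans (sym b↦c) (trans (cong (λ b → φ (g b)) (one-out e e′)) b′↦c′)

    leadsTo : ∀ {a b c} → (∀ {b′} → Edge t a b′ → b′ ≡ b) → φ (g b) ≡ c → LeadsTo (g a) c
    leadsTo {c = c} only-b b↦c α with out⁻ α
    ... | b′ , refl , e = subst (λ b′ → φ (g b′) ≡ c) (sym (only-b e)) b↦c

  embedding : ∀ i → Embedding (block i) (i ,_)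
  embedding i = record
    { arc⁺ = arc
    ; out⁻ = λ { (arc e) → _ , refl , e }
    ; in⁻ = λ { (arc e) → _ , refl , e }
    ; white⁻ = λ a-white → a-white
    ; sameBlock = λ _ _ → refl
    ; φ-injective = injective
    }
    where
    injective : ∀ {a b} → φ (i , a) ≡ φ (i , b) → a ≡ b
    injective a↦b = ,-injectiveʳ-UIP (Decidable⇒UIP.≡-irrelevant _≟_) (sameBlock-unique refl a↦b)

module AroundO {n : ℕ} {E : Multigraph n} (D : BlockDecomposition E) (o w p q y : Fin n)
    (o≢w : o ≢ w) (o≢y : o ≢ y) (p≢q : p ≢ q) (p≢y : p ≢ y) (q≢y : q ≢ y)
    (only-w→o : ∀ x → x ≢ w → E x o ≡ 0)
    (only-o→pqy : ∀ x → x ≢ p → x ≢ q → x ≢ y → E o x ≡ 0)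
    (p→w : 1 ≤ E p w) (q→w : 1 ≤ E q w) (y↛w : E y w ≡ 0) where

  open BlockDecomposition D
  open Glued D

  in-arc-not-from-w : ∀ {z Z} → Arc z Z → φ Z ≡ o → φ z ≢ w →
    White z × ∃₂ λ Z′ z′ → Arc Z′ z′ × φ Z′ ≡ o × ¬ SameBlock Z′ Z × White z′
  in-arc-not-from-w α Z↦o z↦̸w with reverse-arcOver (only-w→o _ z↦̸w) (over α refl Z↦o)
  ... | over {Z′} {z′} β Z′↦o z′↦z with identified z′↦z
  ...   | inj₁ refl = ⊥-elim (reverse-arc-other-block α β (trans Z′↦o (sym Z↦o)) z′↦z (trans (arc-sameBlock β) (arc-sameBlock α)))
  ...   | inj₂ (z′-white , z-white , _) =
    z-white , Z′ , z′ , β , Z′↦o , reverse-arc-other-block α β (trans Z′↦o (sym Z↦o)) z′↦z , z′-white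

  black-in-neighbour↦w : ∀ {z Z} → Arc z Z → φ Z ≡ o → ¬ White z → φ z ≡ w
  black-in-neighbour↦w {z} α Z↦o z-black with φ z ≟ w
  ... | yes z↦w = z↦w
  ... | no z↦̸w = ⊥-elim (z-black (proj₁ (in-arc-not-from-w α Z↦o z↦̸w)))

  black-in-neighbours-equal : ∀ {z₁ z₂ Z} → Arc z₁ Z → Arc z₂ Z → φ Z ≡ o →
    ¬ White z₁ → ¬ White z₂ → z₁ ≡ z₂
  black-in-neighbours-equal α₁ α₂ Z↦o z₁-black z₂-black = black-unique z₂-black
    (trans (black-in-neighbour↦w α₁ Z↦o z₁-black) (sym (black-in-neighbour↦w α₂ Z↦o z₂-black)))

  black-out-neighbour : ∀ {Z z} → Arc Z z → φ Z ≡ o → ¬ White z → φ z ≡ p ⊎ φ z ≡ q ⊎ φ z ≡ y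
  black-out-neighbour {Z} {z} α Z↦o z-black with φ z ≟ p | φ z ≟ q | φ z ≟ y
  ... | yes z↦p | _ | _ = inj₁ z↦p
  ... | no _ | yes z↦q | _ = inj₂ (inj₁ z↦q)
  ... | no _ | no _ | yes z↦y = inj₂ (inj₂ z↦y)
  ... | no z↦̸p | no z↦̸q | no z↦̸y
    with reverse-arcOver (only-o→pqy _ z↦̸p z↦̸q z↦̸y) (over α Z↦o refl)
  ... | over β s↦z t↦o =
    ⊥-elim (reverse-arc-other-block α β s↦z (trans t↦o (sym Z↦o)) (cong proj₁ (black-unique z-black s↦z)))

  black-out-to-w : ∀ {z c} → ¬ White z → φ z ≡ c → 1 ≤ E c w → OutTo z w
  black-out-to-w z-black z↦c c→w with arcOver-of-edge c→w
  ... | over {_} {t} α s↦c t↦w with black-unique z-black (trans s↦c (sym z↦c))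
  ...   | refl = t , α , t↦w

  no-arc-over-y-w : ∀ {s₁ s₂} → s₁ ≢ s₂ → φ s₁ ≡ w → φ s₂ ≡ w → LeadsTo s₁ o → LeadsTo s₂ o →
    ¬ ArcOver y w
  no-arc-over-y-w s₁≢s₂ s₁↦w s₂↦w s₁-leads s₂-leads α with reverse-arcOver y↛w α
  ... | over β s↦w t↦y with fibre≤2 s₁≢s₂ (trans s₁↦w (sym s₂↦w)) (trans s↦w (sym s₁↦w))
  ...   | inj₁ refl = o≢y (trans (sym (s₁-leads β)) t↦y)
  ...   | inj₂ refl = o≢y (trans (sym (s₂-leads β)) t↦y)

  black-in-positions-equal : ∀ {t g} → Embedding t g → ∀ {v a b} → φ (g v) ≡ o → Edge t a v → Edge t b v →
    white t a ≡ false → white t b ≡ false → a ≡ b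
  black-in-positions-equal G v↦o ea eb a-black b-black =
    φ-injective (cong φ (black-in-neighbours-equal (arc⁺ ea) (arc⁺ eb) v↦o (black a-black) (black b-black)))
    where open Embedding G

  -- Excluded: black nodes, and nodes with two black in-neighbours (both would lie over w).
  data PreimagePosition : (t : BlockType) → Fin (size t) → Set where
    spike-tail : PreimagePosition spike n0
    spike-head : PreimagePosition spike n1
    triangle-node : ∀ v → PreimagePosition triangle v
    forkOut-centre : PreimagePosition forkOut n0
    diamond-head : PreimagePosition diamond n1

  preimagePosition : ∀ {t g} → Embedding t g → ∀ v → φ (g v) ≡ o → White (g v) → PreimagePosition t v
  preimagePosition {spike} G zero _ _ = spike-tail
  preimagePosition {spike} G (suc zero) _ _ = spike-head
  preimagePosition {triangle} G v _ _ = triangle-node v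
  preimagePosition {forkOut} G zero _ _ = forkOut-centre
  preimagePosition {forkOut} G (suc _) _ v-white = ⊥-elim (Embedding.black G refl v-white)
  preimagePosition {forkIn} G zero v↦o _ with black-in-positions-equal G v↦o (edge! forkIn n1 n0) (edge! forkIn n2 n0) refl refl
  ... | ()
  preimagePosition {forkIn} G (suc _) _ v-white = ⊥-elim (Embedding.black G refl v-white)
  preimagePosition {diamond} G zero v↦o _
    with black-in-positions-equal G v↦o (edge! diamond n2 n0) (edge! diamond n3 n0) refl refl
  ... | ()
  preimagePosition {diamond} G (suc zero) _ _ = diamond-head
  preimagePosition {diamond} G (suc (suc _)) _ v-white = ⊥-elim (Embedding.black G refl v-white)
  preimagePosition {square} G zero v↦o _
    with black-in-positions-equal G v↦o (edge! square n2 n0) (edge! square n4 n0) refl refl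
  ... | ()
  preimagePosition {square} G (suc _) _ v-white = ⊥-elim (Embedding.black G refl v-white)

  forkOut-leaf-cannot-reach-w : ∀ {h} (H : Embedding forkOut h) {c} → 1 ≤ E c w → ¬ OutTo (h n0) c
  forkOut-leaf-cannot-reach-w H c→w centre-c with Embedding.outTo⁻ H centre-c
  ... | _ , e , b↦c
    with Embedding.outTo⁻ H (black-out-to-w (Embedding.black H (forkOut-leaf-black e)) b↦c c→w)
  ...   | _ , e′ , _ = forkOut-no-path e e′

  diamond-tail-over-w : ∀ {h} (H : Embedding diamond h) {c} → 1 ≤ E c w → OutTo (h n1) c → φ (h n0) ≡ w
  diamond-tail-over-w {h} H c→w head-c with Embedding.outTo⁻ H head-c
  ... | _ , e , f↦c
    with Embedding.outTo⁻ H (black-out-to-w (Embedding.black H (diamond-foot-black e)) f↦c c→w)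
  ...   | _ , e′ , b↦w = subst (λ b → φ (h b) ≡ w) (diamond-out-of-foot e e′) b↦w

  IsDiamond : (t : BlockType) → (Fin (size t) → Node) → Set
  IsDiamond t g = Σ (t ≡ diamond) λ eq →
    φ (g (castNode eq n0)) ≡ w × φ (g (castNode eq n1)) ≡ o ×
    ((φ (g (castNode eq n2)) ≡ p × φ (g (castNode eq n3)) ≡ q) ⊎
     (φ (g (castNode eq n2)) ≡ q × φ (g (castNode eq n3)) ≡ p))

  IsSpike : (t : BlockType) → (Fin (size t) → Node) → Set
  IsSpike t g = Σ (t ≡ spike) λ eq → φ (g (castNode eq n0)) ≡ o × φ (g (castNode eq n1)) ≡ y

  pqy-distinct : ¬ (p ≡ q ⊎ p ≡ y ⊎ q ≡ y)
  pqy-distinct = [ p≢q , [ p≢y , q≢y ] ]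

  module CentreAtDiamondHead {g} (G : Embedding diamond g) (head↦o : φ (g n1) ≡ o) (tail↦w : φ (g n0) ≡ w) where
    open Embedding G

    foot↦p-or-q : ∀ {f} → Edge diamond n1 f → φ (g f) ≡ p ⊎ φ (g f) ≡ q
    foot↦p-or-q e with black-out-neighbour (arc⁺ e) head↦o (black (diamond-foot-black e))
    ... | inj₁ f↦p = inj₁ f↦p
    ... | inj₂ (inj₁ f↦q) = inj₂ f↦q
    -- A foot over y makes its arc to the tail an arc over y → w, whose cancelling arc enters
    -- the foot and so leaves the head, which lies over o ≠ w.
    ... | inj₂ (inj₂ f↦y) with reverse-arcOver y↛w (over (arc⁺ (diamond-foot-to-tail e)) f↦y tail↦w)
    ...   | over β s↦w t↦y with black-unique (black (diamond-foot-black e)) (trans t↦y (sym f↦y))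
    ...     | refl with in⁻ β
    ...       | a , refl , ea =
      ⊥-elim (o≢w (trans (sym head↦o) (subst (λ a → φ (g a) ≡ w) (diamond-in-of-foot e ea) s↦w)))

    feet↦pq : (φ (g n2) ≡ p × φ (g n3) ≡ q) ⊎ (φ (g n2) ≡ q × φ (g n3) ≡ p)
    feet↦pq with foot↦p-or-q (edge! diamond n1 n2) | foot↦p-or-q (edge! diamond n1 n3)
    ... | inj₁ a | inj₂ b = inj₁ (a , b)
    ... | inj₂ a | inj₁ b = inj₂ (a , b)
    ... | inj₁ a | inj₁ b with φ-injective (trans a (sym b))
    ...   | ()
    feet↦pq | inj₂ a | inj₂ b with φ-injective (trans a (sym b))
    ...   | ()

    foot-over : ∀ {c} → c ≡ p ⊎ c ≡ q → ∃ λ f → Edge diamond n1 f × φ (g f) ≡ c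
    foot-over (inj₁ refl) with feet↦pq
    ... | inj₁ (f↦p , _) = n2 , edge! diamond n1 n2 , f↦p
    ... | inj₂ (_ , f↦p) = n3 , edge! diamond n1 n3 , f↦p
    foot-over (inj₂ refl) with feet↦pq
    ... | inj₁ (_ , f↦q) = n3 , edge! diamond n1 n3 , f↦q
    ... | inj₂ (f↦q , _) = n2 , edge! diamond n1 n2 , f↦q

    over-p-or-q : ∀ {z} → φ z ≡ p ⊎ φ z ≡ q → SameBlock z (g n1)
    over-p-or-q z↦pq with foot-over z↦pq
    ... | f , e , f↦z with black-unique (black (diamond-foot-black e)) (sym f↦z)
    ...   | refl = sameBlock f n1

    head-out-black : ∀ {z} → Arc (g n1) z → ¬ White z
    head-out-black α with out⁻ α
    ... | _ , refl , e = black (diamond-foot-black e)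

    head-out-not-y : ∀ {z} → Arc (g n1) z → φ z ≢ y
    head-out-not-y α z↦y with out⁻ α
    ... | _ , refl , e = [ (λ f↦p → p≢y (trans (sym f↦p) z↦y)) , (λ f↦q → q≢y (trans (sym f↦q) z↦y)) ]
                         (foot↦p-or-q e)

    module _ {Y} (Y↦o : φ Y ≡ o) (other : ¬ SameBlock (g n1) Y) where

      Y-out-y : ArcOver o y → OutTo Y y
      Y-out-y α with split-arcOver (¬sameBlock⇒≢ other) head↦o Y↦o α
      ... | inj₁ (_ , β , z↦y) = ⊥-elim (head-out-not-y β z↦y)
      ... | inj₂ out = out

      Y-black-out↦y : ∀ {z} → Arc Y z → ¬ White z → φ z ≡ y
      Y-black-out↦y {z} α z-black with black-out-neighbour α Y↦o z-black
      ... | inj₂ (inj₂ z↦y) = z↦y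
      ... | inj₁ z↦p = ⊥-elim (other (trans (sym (over-p-or-q (inj₁ z↦p))) (sym (arc-sameBlock α))))
      ... | inj₂ (inj₁ z↦q) = ⊥-elim (other (trans (sym (over-p-or-q (inj₂ z↦q))) (sym (arc-sameBlock α))))

    Y-two-black-outs : ∀ {t h v} (H : Embedding t h) → φ (h v) ≡ o → ¬ SameBlock (g n1) (h v) →
      ∀ {a b} → Edge t v a → Edge t v b → white t a ≡ false → white t b ≡ false → a ≡ b
    Y-two-black-outs H Y↦o other ea eb a-black b-black = H.φ-injective
      (trans (Y-black-out↦y Y↦o other (H.arc⁺ ea) (H.black a-black))
             (sym (Y-black-out↦y Y↦o other (H.arc⁺ eb) (H.black b-black))))
      where module H = Embedding H

    no-triangle-beside : ∀ {h} (H : Embedding triangle h) v → φ (h v) ≡ o → ¬ SameBlock (g n1) (h v) →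
      ¬ OutTo (h v) y
    -- r = h (prev v) and t = h (next v) are the in- and out-neighbour of Y = h v; t lies over y.
    -- If r lies over w, the arc t → r is over y → w; otherwise the arc r → Y must be cancelled
    -- by an arc from the head to a white node, but the head only leads to black feet.
    no-triangle-beside {h} H v Y↦o other Y-y with φ (h (prev v)) ≟ w
    ... | yes r↦w = no-arc-over-y-w tail≢r tail↦w r↦w (leadsTo diamond-out-of-tail head↦o)
                     (H.leadsTo (λ e → trans (triangle-out e) (next-prev v)) Y↦o)
                     (over (H.arc⁺ (triangle-edge (next v))) t↦y r↦w)
      where
      module H = Embedding H
      tail≢r : g n0 ≢ h (prev v)
      tail≢r eq = other (trans (sameBlock n1 n0) (trans (cong proj₁ eq) (H.sameBlock (prev v) v)))
      t↦y : φ (h (next v)) ≡ y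
      t↦y with H.outTo⁻ Y-y
      ... | b , e , b↦y = subst (λ b → φ (h b) ≡ y) (triangle-out e) b↦y
    ... | no r↦̸w with in-arc-not-from-w (Embedding.arc⁺ H (triangle-edge-into v)) Y↦o r↦̸w
    ...   | _ , Z′ , _ , β , Z′↦o , ¬same , z′-white
      with fibre≤2 (¬sameBlock⇒≢ other) (trans head↦o (sym Y↦o)) (trans Z′↦o (sym head↦o))
    ...     | inj₁ refl = head-out-black β z′-white
    ...     | inj₂ refl = ¬same refl

    other-preimage-is-spike : ∀ {t h v} (H : Embedding t h) → PreimagePosition t v → φ (h v) ≡ o →
      ¬ SameBlock (g n1) (h v) → ArcOver o y → IsSpike t h
    other-preimage-is-spike {h = h} H spike-tail Y↦o other α with Embedding.outTo⁻ H (Y-out-y Y↦o other α)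
    ... | b , e , b↦y = refl , Y↦o , subst (λ b → φ (h b) ≡ y) (proj₂ (spike-edge e)) b↦y
    other-preimage-is-spike H spike-head Y↦o other α with Embedding.outTo⁻ H (Y-out-y Y↦o other α)
    ... | _ , e , _ with spike-edge e
    ...   | () , _
    other-preimage-is-spike H (triangle-node v) Y↦o other α =
      ⊥-elim (no-triangle-beside H v Y↦o other (Y-out-y Y↦o other α))
    other-preimage-is-spike H forkOut-centre Y↦o other α
      with Y-two-black-outs H Y↦o other (edge! forkOut n0 n1) (edge! forkOut n0 n2) refl refl
    ... | ()
    other-preimage-is-spike H diamond-head Y↦o other α
      with Y-two-black-outs H Y↦o other (edge! diamond n1 n2) (edge! diamond n1 n3) refl refl
    ... | ()

  module CentreInTriangle {g} (G : Embedding triangle g) (v : Fin 3)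
      (X↦o : φ (g v) ≡ o) (r↦w : φ (g (prev v)) ≡ w) where
    open Embedding G

    r-leads-to-o : LeadsTo (g (prev v)) o
    r-leads-to-o = leadsTo (λ e → trans (triangle-out e) (next-prev v)) X↦o

    X-out : ∀ {c} → OutTo (g v) c → φ (g (next v)) ≡ c
    X-out {c} X-c with outTo⁻ X-c
    ... | b , e , b↦c = subst (λ b → φ (g b) ≡ c) (triangle-out e) b↦c

    other-preimage-impossible : ∀ {t h v′} (H : Embedding t h) → PreimagePosition t v′ → φ (h v′) ≡ o →
      ¬ SameBlock (g v) (h v′) → ∀ {c₁ c₂} → 1 ≤ E c₁ w → c₁ ≢ c₂ →
      OutTo (h v′) c₁ → OutTo (h v′) c₂ → OutTo (h v′) y ⊎ ArcOver y w → ⊥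
    other-preimage-impossible H spike-tail _ _ _ c₁≢c₂ Y-c₁ Y-c₂ _ = 
      c₁≢c₂ (Embedding.same-out-image H spike-out-unique Y-c₁ Y-c₂)
    other-preimage-impossible H spike-head _ _ _ c₁≢c₂ Y-c₁ Y-c₂ _ = 
      c₁≢c₂ (Embedding.same-out-image H spike-out-unique Y-c₁ Y-c₂)
    other-preimage-impossible H (triangle-node _) _ _ _ c₁≢c₂ Y-c₁ Y-c₂ _ = 
      c₁≢c₂ (Embedding.same-out-image H triangle-out-unique Y-c₁ Y-c₂)
    other-preimage-impossible H forkOut-centre _ _ c₁→w _ Y-c₁ _ _ = forkOut-leaf-cannot-reach-w H c₁→w Y-c₁
    other-preimage-impossible {h = h} H diamond-head Y↦o other c₁→w _ Y-c₁ _ y-link =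
      no-arc-over-y-w r≢tail r↦w tail↦w r-leads-to-o (Embedding.leadsTo H diamond-out-of-tail Y↦o) (arc-over-y-w y-link)
      where
      tail↦w : φ (h n0) ≡ w
      tail↦w = diamond-tail-over-w H c₁→w Y-c₁
      r≢tail : g (prev v) ≢ h n0
      r≢tail eq = other (trans (sameBlock v (prev v)) (trans (cong proj₁ eq) (Embedding.sameBlock H n0 n1)))
      arc-over-y-w : OutTo (h n1) y ⊎ ArcOver y w → ArcOver y w
      arc-over-y-w (inj₂ α) = α
      arc-over-y-w (inj₁ Y-y) with Embedding.outTo⁻ H Y-y
      ... | _ , e , f↦y = over (Embedding.arc⁺ H (diamond-foot-to-tail e)) f↦y tail↦w

    module _ {Y} (Y↦o : φ Y ≡ o) (Y-white : White Y) (other : ¬ SameBlock (g v) Y) where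

      via-Y : ∀ {c} → φ (g (next v)) ≢ c → ArcOver o c → OutTo Y c
      via-Y t↦̸c α with split-arcOver (¬sameBlock⇒≢ other) X↦o Y↦o α
      ... | inj₁ X-c = ⊥-elim (t↦̸c (X-out X-c))
      ... | inj₂ Y-c = Y-c

      Y-impossible : ∀ {c₁ c₂} → 1 ≤ E c₁ w → c₁ ≢ c₂ → OutTo Y c₁ → OutTo Y c₂ → OutTo Y y ⊎ ArcOver y w → ⊥
      Y-impossible = other-preimage-impossible H (preimagePosition H (proj₂ Y) Y↦o Y-white) Y↦o other
        where H = embedding (proj₁ Y)

      -- X leads only to t = g (next v), so at most one of the arcs over o → p, o → q, o → y
      -- leaves X; the others leave Y.
      centre-impossible : ArcOver o p → ArcOver o q → ArcOver o y → ⊥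
      centre-impossible α-p α-q α-y
        with split-arcOver (¬sameBlock⇒≢ other) X↦o Y↦o α-y
      ... | inj₁ X-y = Y-impossible p→w p≢q
              (via-Y (λ t↦p → p≢y (trans (sym t↦p) (X-out X-y))) α-p)
              (via-Y (λ t↦q → q≢y (trans (sym t↦q) (X-out X-y))) α-q)
              (inj₂ (over (arc⁺ (triangle-edge (next v))) (X-out X-y) r↦w))
      ... | inj₂ Y-y with split-arcOver (¬sameBlock⇒≢ other) X↦o Y↦o α-p
      ...   | inj₂ Y-p = Y-impossible p→w p≢y Y-p Y-y (inj₁ Y-y)
      ...   | inj₁ X-p = Y-impossible q→w q≢y
              (via-Y (λ t↦q → p≢q (trans (sym (X-out X-p)) t↦q)) α-q) Y-y (inj₁ Y-y)

  module _ {Y} (Y↦o : φ Y ≡ o) (Y-white : White Y)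
      (α-p : ArcOver o p) (α-q : ArcOver o q) (α-y : ArcOver o y) where

    centre-is-diamond : ∀ {t g v} (G : Embedding t g) → PreimagePosition t v → φ (g v) ≡ o →
      ¬ SameBlock (g v) Y → ∀ {sw} → Arc sw (g v) → φ sw ≡ w →
      IsDiamond t g × ∃ λ j → IsSpike (block j) (j ,_)
    centre-is-diamond G spike-tail _ _ α _ with Embedding.in⁻ G α
    ... | _ , _ , e with spike-edge e
    ...   | _ , ()
    centre-is-diamond G forkOut-centre _ _ α _ with Embedding.in⁻ G α
    ... | _ , _ , e with forkOut-edge e
    ...   | _ , inj₁ ()
    ...   | _ , inj₂ ()
    centre-is-diamond G spike-head X↦o other _ _ =
      ⊥-elim (pqy-distinct (out-images≤2 (via-Y α-p) (via-Y α-q) (via-Y α-y)))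
      where
      via-Y : ∀ {c} → ArcOver o c → OutTo Y c
      via-Y α with split-arcOver (¬sameBlock⇒≢ other) X↦o Y↦o α
      ... | inj₂ Y-c = Y-c
      ... | inj₁ X-c with Embedding.outTo⁻ G X-c
      ...   | _ , e , _ with spike-edge e
      ...     | () , _
    centre-is-diamond {g = g} G (triangle-node v) X↦o other α sw↦w with Embedding.in⁻ G α
    ... | _ , refl , e = ⊥-elim (CentreInTriangle.centre-impossible G v X↦o
            (subst (λ b → φ (g b) ≡ w) (triangle-in e) sw↦w) Y↦o Y-white other α-p α-q α-y)
    centre-is-diamond {g = g} G diamond-head X↦o other α sw↦w with Embedding.in⁻ G α
    ... | _ , refl , e =
      let tail↦w = subst (λ b → φ (g b) ≡ w) (diamond-in-of-head e) sw↦w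
          open CentreAtDiamondHead G X↦o tail↦w
          H = embedding (proj₁ Y)
      in (refl , tail↦w , X↦o , feet↦pq) ,
         proj₁ Y , other-preimage-is-spike H (preimagePosition H (proj₂ Y) Y↦o Y-white) Y↦o other α-y

  second-preimage : ∀ {X} → ArcOver o p → ArcOver o q → ArcOver o y → ∃ λ Y → φ Y ≡ o × X ≢ Y
  second-preimage {X} (over {Xp} αp Xp↦o tp↦p) (over {Xq} αq Xq↦o tq↦q) (over {Xy} αy Xy↦o ty↦y)
    with Xp ≟ᴺ X | Xq ≟ᴺ X | Xy ≟ᴺ X
  ... | no Xp≢X | _ | _ = Xp , Xp↦o , λ X≡Xp → Xp≢X (sym X≡Xp)
  ... | yes _ | no Xq≢X | _ = Xq , Xq↦o , λ X≡Xq → Xq≢X (sym X≡Xq)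
  ... | yes _ | yes _ | no Xy≢X = Xy , Xy↦o , λ X≡Xy → Xy≢X (sym X≡Xy)
  ... | yes refl | yes refl | yes refl =
    ⊥-elim (pqy-distinct (out-images≤2 (_ , αp , tp↦p) (_ , αq , tq↦q) (_ , αy , ty↦y)))

  diamond-and-spike : ArcOver w o → ArcOver o p → ArcOver o q → ArcOver o y →
    (∃ λ i → IsDiamond (block i) (i ,_)) × (∃ λ j → IsSpike (block j) (j ,_))
  diamond-and-spike (over {_} {X} α sw↦w X↦o) α-p α-q α-y with second-preimage α-p α-q α-y
  ... | Y , Y↦o , X≢Y with identified (trans X↦o (sym Y↦o))
  ...   | inj₁ X≡Y = ⊥-elim (X≢Y X≡Y)
  ...   | inj₂ (X-white , Y-white , other)
    with centre-is-diamond Y↦o Y-white α-p α-q α-y (embedding (proj₁ X))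
           (preimagePosition (embedding (proj₁ X)) (proj₂ X) X↦o X-white) X↦o other α sw↦w
  ...     | X-diamond , Y-spike = (proj₁ X , X-diamond) , Y-spike

mainTheorem3 : ∀ {n : ℕ} (E : Multigraph n) → NoLoops E → No2Cycles E →
    BlockDecomposable E →
    (o w p q y : Fin n) →
    o ≢ w → o ≢ p → o ≢ q → o ≢ y → w ≢ p → w ≢ q → w ≢ y → p ≢ q → p ≢ y → q ≢ y →
    E w o ≡ 1 → E o p ≡ 1 → E o q ≡ 1 → E o y ≡ 1 →
    (∀ x → x ≢ w → E x o ≡ 0) →
    (∀ x → x ≢ p → x ≢ q → x ≢ y → E o x ≡ 0) →
    1 ≤ E p w → 1 ≤ E q w →
    E y w ≡ 0 → E w y ≡ 0 →
    (D : BlockDecomposition E) →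
    let open BlockDecomposition D in
    (Σ (Fin m) λ i → Σ (block i ≡ diamond) λ eq →
       φ (i , castNode eq n0) ≡ w × φ (i , castNode eq n1) ≡ o ×
       ((φ (i , castNode eq n2) ≡ p × φ (i , castNode eq n3) ≡ q) ⊎ (φ (i , castNode eq n2) ≡ q × φ (i , castNode eq n3) ≡ p)))
    ×
    (Σ (Fin m) λ j → Σ (block j ≡ spike) λ eq →
       φ (j , castNode eq n0) ≡ o × φ (j , castNode eq n1) ≡ y)
mainTheorem3 E _ _ _ o w p q y o≢w _ _ o≢y _ _ _ p≢q p≢y q≢y w→o o→p o→q o→y only-w→o only-o→pqy p→w q→w y↛w _ D =
  diamond-and-spike (lift w→o) (lift o→p) (lift o→q) (lift o→y)
  where
  open Glued D
  open AroundO D o w p q y o≢w o≢y p≢q p≢y q≢y only-w→o only-o→pqy p→w q→w y↛w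
  lift : ∀ {a b} → E a b ≡ 1 → ArcOver a b
  lift ab≡1 = arcOver-of-edge (subst (1 ≤_) (sym ab≡1) (s≤s z≤n))
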